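{- Let $n$ be a positive integer. (a) For any positive integer $c\leq \max_{k\in\mathbb{Z}_{>0}}\bigl(2^kn-(k+2^k-2)2^k-1\bigr)$, there is an arithmetical structure on $K_n$ with $r_1=c$. (b) For any prime number $p\leq \max_{k\in\mathbb{Z}_{>0}}\bigl(2^kn-(k+2^k-3)2^k-3\bigr)$, there is an arithmetical structure on $K_n$ with $r_1=p$.
   Context: An arithmetical structure on the complete graph $K_n$ (with $n$ vertices) is a collection of positive integers $r_1,r_2,\dotsc,r_n$ with no nontrivial common factor (i.e. $\gcd(r_1,\dotsc,r_n)=1$) such that $r_j$ divides $\sum_{i=1}^n r_i$ for every $j$. The values are always ordered so that $r_1\geq r_2\geq\dotsb\geq r_n$; thus $r_1$ denotes the largest value of the structure. -}

module Defs where

open import Data.Nat using (ℕ; suc; _≤_; _^_)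
open import Data.Nat.Divisibility using (_∣_)
open import Data.Fin using (Fin)
import Data.Fin as Fin
open import Data.Vec using (Vec; lookup; sum)
open import Data.Integer as ℤ using (ℤ; +_; _-_; _*_; _+_)
open import Data.Product using (_×_)
open import Relation.Binary.PropositionalEquality using (_≡_)

-- An arithmetical structure on K_n: positive integers r_1 ≥ … ≥ r_n
-- (r_1 = lookup r zero), no nontrivial common factor, each r_j ∣ Σ r_i.
record IsArithmeticalStructure {n : ℕ} (r : Vec ℕ n) : Set where
  field
    positive   : ∀ (i : Fin n) → 1 ≤ lookup r i
    noCommon   : ∀ (d : ℕ) → (∀ (i : Fin n) → d ∣ lookup r i) → d ≡ 1
    divides    : ∀ (j : Fin n) → lookup r j ∣ sum r
    decreasing : ∀ (i j : Fin n) → i Fin.≤ j → lookup r j ≤ lookup r i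

boundA : ℕ → ℕ → ℤ
boundA n k = (+ (2 ^ k)) * (+ n) - ((+ k) + (+ (2 ^ k)) - + 2) * (+ (2 ^ k)) - + 1

boundB : ℕ → ℕ → ℤ
boundB n k = (+ (2 ^ k)) * (+ n) - ((+ k) + (+ (2 ^ k)) - + 3) * (+ (2 ^ k)) - + 3

{-# OPTIONS --safe #-}
-- If c ≤ m, take c with m - c further copies of c and c ones. Otherwise
-- let P = 2^k and take c, P - 2 further copies of c, and L = m + 2 - P powers of two
-- dividing P that sum to c, one of them equal to 1: the total is P c, a multiple of
-- every entry, and the 1 makes the gcd trivial. Splitting c - 1 greedily into powers
-- of two dividing 2^k and halving parts one at a time realises every number of parts
-- from the greedy count up to c - 1; the bound in (a) is exactly what makes the greedy
-- count of c - 1 smaller than L. In (b) the prime p is odd (p = 2 violates the bound),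
-- so p - 1 = 2h and the greedy count of 2h at level k is that of h at level k - 1,
-- which buys the extra room in the weaker bound.
module Submission where

open import Defs
open import Data.Nat
  using (ℕ; zero; suc; _+_; >-nonZero⁻¹; _*_; _∸_; _^_; _≤_; _<_; _≥_; _≤?_; z≤n; s≤s; s≤s⁻¹; z<s)
open import Data.Nat.Properties
open import Data.Nat.DivMod
  using (_/_; _%_; m≡m%n+[m/n]*n; m%n<n; m<n*o⇒m/o<n; m*n%n≡0; m*n/n≡m)
open import Data.Nat.Divisibility using (_∣_; 1∣_; n∣m*n; ∣m⇒∣m*n; *-monoʳ-∣; 0∣⇒≡0; ∣1⇒≡1; m%n≡0⇒n∣m)
open import Data.Nat.Primality using (Prime; composite-≢; prime⇒nonZero; prime⇒¬composite)
open import Data.Nat.ListAction using (sum)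
open import Data.Nat.ListAction.Properties using (sum-++)
import Data.Nat.Tactic.RingSolver as ℕ-Solver
open import Data.Integer as ℤ using (+_)
import Data.Integer.Properties as ℤₚ
import Data.Integer.Tactic.RingSolver as ℤ-Solver
open import Data.Fin as Fin using (zero; suc)
open import Data.List using (List; []; _∷_; _++_; replicate; map; length)
open import Data.List.Properties using (length-++; length-map; length-replicate)
open import Data.List.Membership.Propositional using (_∈_)
open import Data.List.Relation.Unary.All as All using (All; []; _∷_)
import Data.List.Relation.Unary.All.Properties as All
open import Data.List.Relation.Unary.Any using (here; there)
import Data.List.Relation.Unary.Any.Properties as Any
open import Data.List.Relation.Unary.AllPairs as AllPairs using (AllPairs; []; _∷_)
import Data.List.Relation.Unary.AllPairs.Properties as AllPairs
open import Data.Vec as Vec using (lookup; fromList)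
import Data.Vec.Relation.Unary.All as VecAll
import Data.Vec.Relation.Unary.All.Properties as VecAll
import Data.Vec.Relation.Unary.Any.Properties as VecAny
open import Data.Product using (_×_; _,_; ∃-syntax)
open import Data.Sum using (_⊎_; inj₁; inj₂)
open import Function using (_∘_)
open import Relation.Binary.PropositionalEquality
open import Relation.Nullary using (yes; no; contradiction)

sum-replicate : ∀ n x → sum (replicate n x) ≡ n * x
sum-replicate zero    x = refl
sum-replicate (suc n) x = cong (_+_ x) (sum-replicate n x)

sum-map-*ˡ : ∀ n xs → sum (map (n *_) xs) ≡ n * sum xs
sum-map-*ˡ n []       = sym (*-zeroʳ n)
sum-map-*ˡ n (x ∷ xs) = trans (cong (_+_ (n * x)) (sum-map-*ˡ n xs)) (sym (*-distribˡ-+ n x (sum xs)))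

All-≤-sum : ∀ xs → All (_≤ sum xs) xs
All-≤-sum []       = []
All-≤-sum (x ∷ xs) = m≤m+n x (sum xs) ∷ All.map (λ y≤ → ≤-trans y≤ (m≤n+m (sum xs) x)) (All-≤-sum xs)

replicate-decreasing : ∀ n x → AllPairs _≥_ (replicate n x)
replicate-decreasing zero    x = []
replicate-decreasing (suc n) x = All.replicate⁺ n ≤-refl ∷ replicate-decreasing n x

divisor-positive : ∀ {d n} → 0 < n → d ∣ n → 0 < d
divisor-positive {zero}  0<n 0∣n = contradiction (0∣⇒≡0 0∣n) (>⇒≢ 0<n)
divisor-positive {suc d} _   _   = z<s

even-prime : ∀ {p} → Prime p → 2 ∣ p → p ≡ 2
even-prime {p} pr 2∣p with p ≟ 2
... | yes p≡2 = p≡2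
... | no  p≢2 = contradiction (composite-≢ 2 {{_}} {{prime⇒nonZero pr}} (p≢2 ∘ sym) 2∣p) (prime⇒¬composite pr)

even⊎odd : ∀ n → 2 ∣ n ⊎ n ≡ suc (n / 2 * 2)
even⊎odd n with n % 2 | m%n<n n 2 | m≡m%n+[m/n]*n n 2 | m%n≡0⇒n∣m n 2
... | zero        | _            | _  | 2∣n = inj₁ (2∣n refl)
... | suc zero    | _            | n≡ | _   = inj₂ n≡
... | suc (suc _) | s≤s (s≤s ()) | _  | _

m*2^[1+n]≡m*2^n*2 : ∀ q k → q * 2 ^ suc k ≡ q * 2 ^ k * 2
m*2^[1+n]≡m*2^n*2 q k = trans (cong (q *_) (*-comm 2 (2 ^ k))) (sym (*-assoc q (2 ^ k) 2))

2^k≡2+r : ∀ k → 0 < k → ∃[ r ] 2 ^ k ≡ 2 + r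
2^k≡2+r (suc j) _ with m≤n⇒∃[o]m+o≡n (*-monoʳ-≤ 2 (m^n>0 2 j))
... | r , 2+r≡ = r , sym 2+r≡

record Partition (P x L : ℕ) : Set where
  field
    parts      : List ℕ
    decreasing : AllPairs _≥_ parts
    divisors   : All (_∣ P) parts
    sum≡       : sum parts ≡ x
    length≡    : length parts ≡ L

open Partition

cast : ∀ {P P′ x x′ L L′} → P ≡ P′ → x ≡ x′ → L ≡ L′ → Partition P x L → Partition P′ x′ L′
cast P≡ x≡ L≡ π = record
  { parts      = parts π
  ; decreasing = decreasing π
  ; divisors   = subst (λ P → All (_∣ P) (parts π)) P≡ (divisors π)
  ; sum≡       = trans (sum≡ π) x≡
  ; length≡    = trans (length≡ π) L≡
  }

ones : ∀ P x → Partition P x x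
ones P x = record
  { parts      = replicate x 1
  ; decreasing = replicate-decreasing x 1
  ; divisors   = All.replicate⁺ x (1∣ P)
  ; sum≡       = trans (sum-replicate x 1) (*-identityʳ x)
  ; length≡    = length-replicate x
  }

double : ∀ {P x L} → Partition P x L → Partition (2 * P) (2 * x) L
double π = record
  { parts      = map (2 *_) (parts π)
  ; decreasing = AllPairs.map⁺ (AllPairs.map (*-monoʳ-≤ 2) (decreasing π))
  ; divisors   = All.map⁺ (All.map (*-monoʳ-∣ 2) (divisors π))
  ; sum≡       = trans (sum-map-*ˡ 2 (parts π)) (cong (2 *_) (sum≡ π))
  ; length≡    = trans (length-map (2 *_) (parts π)) (length≡ π)
  }

addOnes : ∀ {P x L} → 0 < P → ∀ e → Partition P x L → Partition P (e + x) (e + L)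
addOnes {x = x} {L} 0<P e π = record
  { parts      = parts π ++ replicate e 1
  ; decreasing = AllPairs.++⁺ (decreasing π) (replicate-decreasing e 1)
                   (All.map (All.replicate⁺ e ∘ divisor-positive 0<P) (divisors π))
  ; divisors   = All.++⁺ (divisors π) (All.replicate⁺ e (1∣ _))
  ; sum≡       = begin
      sum (parts π ++ replicate e 1)           ≡⟨ sum-++ (parts π) (replicate e 1) ⟩
      sum (parts π) + sum (replicate e 1)      ≡⟨ cong₂ _+_ (sum≡ π) (sum-replicate e 1) ⟩
      x + e * 1                                ≡⟨ cong (_+_ x) (*-identityʳ e) ⟩
      x + e                                    ≡⟨ +-comm x e ⟩
      e + x                                    ∎
  ; length≡    = begin
      length (parts π ++ replicate e 1)        ≡⟨ length-++ (parts π) ⟩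
      length (parts π) + length (replicate e 1) ≡⟨ cong₂ _+_ (length≡ π) (length-replicate e) ⟩
      L + e                                    ≡⟨ +-comm L e ⟩
      e + L                                    ∎
  }
  where open ≡-Reasoning

twosAndOnes : ∀ {P} → 0 < P → ∀ b h L → b + h ≤ L → L ≤ b + 2 * h → Partition (2 * P) (b + 2 * h) L
twosAndOnes {P} 0<P b h L b+h≤L L≤ =
  let t , b+h+t≡L = m≤n⇒∃[o]m+o≡n b+h≤L
      a , t+a≡h   = m≤n⇒∃[o]m+o≡n (+-cancelˡ-≤ (b + h) t h (begin
        b + h + t  ≡⟨ b+h+t≡L ⟩
        L          ≤⟨ L≤ ⟩
        b + 2 * h  ≡⟨ double-sum b h ⟩
        b + h + h  ∎))
  in cast refl
       (trans (rearrange-sum b t a) (cong (λ z → b + 2 * z) t+a≡h))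
       (trans (rearrange-length b t a) (trans (cong (λ z → b + z + t) t+a≡h) b+h+t≡L))
       (addOnes (<-≤-trans z<s (*-monoʳ-≤ 2 0<P)) (b + 2 * t) (double (ones P a)))
  where
  open ≤-Reasoning
  double-sum : ∀ b h → b + 2 * h ≡ b + h + h
  double-sum = ℕ-Solver.solve-∀
  rearrange-sum : ∀ b t a → b + 2 * t + 2 * a ≡ b + 2 * (t + a)
  rearrange-sum = ℕ-Solver.solve-∀
  rearrange-length : ∀ b t a → b + 2 * t + a ≡ b + (t + a) + t
  rearrange-length = ℕ-Solver.solve-∀

-- x / 2^k plus the number of 1s among the last k binary digits of x: the fewest
-- powers of two dividing 2^k that sum to x.
minParts : ℕ → ℕ → ℕ
minParts zero    x = x
minParts (suc k) x = x % 2 + minParts k (x / 2)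

minParts-double : ∀ k h → minParts (suc k) (h * 2) ≡ minParts k h
minParts-double k h = cong₂ _+_ (m*n%n≡0 h 2) (cong (minParts k) (m*n/n≡m h 2))

minParts-≤ : ∀ k x q → x < suc q * 2 ^ k → minParts k x ≤ q + k
minParts-≤ zero    x q x< = ≤-trans (s≤s⁻¹ (subst (x <_) (*-identityʳ (suc q)) x<)) (m≤m+n q 0)
minParts-≤ (suc k) x q x< = begin
  x % 2 + minParts k (x / 2) ≤⟨ +-mono-≤ (s≤s⁻¹ (m%n<n x 2)) (minParts-≤ k (x / 2) q x/2<) ⟩
  suc (q + k)                ≡⟨ +-suc q k ⟨
  q + suc k                  ∎
  where
  open ≤-Reasoning
  x/2< : x / 2 < suc q * 2 ^ k
  x/2< = m<n*o⇒m/o<n (subst (x <_) (m*2^[1+n]≡m*2^n*2 (suc q) k) x<)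

minParts-< : ∀ k x q → suc x < suc q * 2 ^ k → minParts k x < q + k
minParts-< zero    x q sx< = ≤-trans (s≤s⁻¹ (subst (suc x <_) (*-identityʳ (suc q)) sx<)) (m≤m+n q 0)
minParts-< (suc k) x q sx< = byParity (x % 2) (m%n<n x 2) (m≡m%n+[m/n]*n x 2)
  where
  sx<′ : suc x < suc q * 2 ^ k * 2
  sx<′ = subst (suc x <_) (m*2^[1+n]≡m*2^n*2 (suc q) k) sx<
  byParity : ∀ b → b < 2 → x ≡ b + x / 2 * 2 → b + minParts k (x / 2) < q + suc k
  byParity 0 _ _ = ≤-trans (s≤s (minParts-≤ k (x / 2) q (m<n*o⇒m/o<n (<-trans (n<1+n x) sx<′))))
    (≤-reflexive (sym (+-suc q k)))
  -- x is odd, so (x / 2 + 1) * 2 = x + 1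
  byParity 1 _ x≡ = ≤-trans (s≤s (minParts-< k (x / 2) q (*-cancelʳ-< 2 _ _ (subst (λ y → suc y < _) x≡ sx<′))))
    (≤-reflexive (sym (+-suc q k)))
  byParity (suc (suc _)) (s≤s (s≤s ())) _

binaryPartition : ∀ k x L → minParts k x ≤ L → L ≤ x → Partition (2 ^ k) x L
binaryPartition zero    x L x≤L L≤x = cast refl refl (≤-antisym x≤L L≤x) (ones 1 x)
binaryPartition (suc k) x L mp≤L L≤x =
  cast refl (sym x≡) refl (split (x % 2) (x / 2) mp≤L (subst (L ≤_) x≡ L≤x))
  where
  x≡ : x ≡ x % 2 + 2 * (x / 2)
  x≡ = trans (m≡m%n+[m/n]*n x 2) (cong (_+_ (x % 2)) (*-comm (x / 2) 2))
  split : ∀ b h → b + minParts k h ≤ L → L ≤ b + 2 * h → Partition (2 ^ suc k) (b + 2 * h) L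
  -- Few parts: double a partition of h and append b ones. Many parts: use only 2s and 1s.
  split b h mp≤L L≤ with ≤-total L (b + h)
  ... | inj₁ L≤b+h = cast refl refl (m+[n∸m]≡n (m+n≤o⇒m≤o b mp≤L))
    (addOnes (m^n>0 2 (suc k)) b (double (binaryPartition k h (L ∸ b)
      (m+n≤o⇒m≤o∸n (minParts k h) (subst (_≤ L) (+-comm b _) mp≤L))
      (m≤n+o⇒m∸n≤o L b L≤b+h))))
  ... | inj₂ b+h≤L = twosAndOnes (m^n>0 2 k) b h L b+h≤L L≤

partitionWithOne : ∀ k x L → minParts k x < L → L ≤ suc x →
  ∃[ π ] (1 ∈ parts {2 ^ k} {suc x} {L} π)
partitionWithOne k x (suc L) (s≤s mp≤L) (s≤s L≤x) =
  addOnes (m^n>0 2 k) 1 π , Any.++⁺ʳ (parts π) (here refl)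
  where π = binaryPartition k x L mp≤L L≤x

-- Structures on K_(m+1), indexed by m as in theorem2p1, with r₁ = c.
StructureWithMax : ℕ → ℕ → Set
StructureWithMax m c = ∃[ r ] (IsArithmeticalStructure {suc m} r × lookup r zero ≡ c)

sum-fromList : ∀ xs → Vec.sum (fromList xs) ≡ sum xs
sum-fromList []       = refl
sum-fromList (x ∷ xs) = cong (_+_ x) (sum-fromList xs)

lookup-fromList-antitone : ∀ {xs} → AllPairs _≥_ xs →
  ∀ i j → i Fin.≤ j → lookup (fromList xs) j ≤ lookup (fromList xs) i
lookup-fromList-antitone (_ ∷ _)   zero    zero    _         = ≤-refl
lookup-fromList-antitone (x≥ ∷ _)  zero    (suc j) _         = VecAll.lookup⁺ (VecAll.fromList⁺ x≥) j
lookup-fromList-antitone (_ ∷ dec) (suc i) (suc j) (s≤s i≤j) = lookup-fromList-antitone dec i j i≤j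

fromList-structure : ∀ {c xs} → AllPairs _≥_ (c ∷ xs) → 1 ∈ c ∷ xs → All (0 <_) (c ∷ xs) →
  All (_∣ sum (c ∷ xs)) (c ∷ xs) → StructureWithMax (length xs) c
fromList-structure {c} {xs} dec one pos dvd = fromList (c ∷ xs) , isStructure , refl
  where
  isStructure : IsArithmeticalStructure (fromList (c ∷ xs))
  isStructure = record
    { positive   = VecAll.lookup⁺ (VecAll.fromList⁺ pos)
    ; noCommon   = λ d d∣ →
        let d∣x , 1≡x = VecAll.lookupAny (VecAll.lookup⁻ {P = d ∣_} d∣) (VecAny.fromList⁺ one)
        in ∣1⇒≡1 (subst (d ∣_) (sym 1≡x) d∣x)
    ; divides    = λ j → subst (lookup (fromList (c ∷ xs)) j ∣_) (sym (sum-fromList (c ∷ xs)))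
                           (VecAll.lookup⁺ (VecAll.fromList⁺ dvd) j)
    ; decreasing = lookup-fromList-antitone dec
    }

-- With r + 1 copies of c in front of the parts, the sum is (2 + r) c.
partition-structure : ∀ r {c L} (π : Partition (2 + r) c L) → 1 ∈ parts π →
  StructureWithMax (r + L) c
partition-structure r {c} {L} π 1∈ =
  subst (λ n → StructureWithMax n c) length-xs
    (fromList-structure (head≥ ∷ tail-decreasing) (there (Any.++⁺ʳ (replicate r c) 1∈))
      (All.lookup parts≤c 1∈ ∷ All.++⁺ (All.replicate⁺ r (All.lookup parts≤c 1∈))
                                      (All.map (divisor-positive z<s) (divisors π)))
      (subst (λ s → All (_∣ s) (c ∷ xs)) (sym sum-xs)
        (n∣m*n (2 + r) ∷ All.++⁺ (All.replicate⁺ r (n∣m*n (2 + r))) (All.map (∣m⇒∣m*n c) (divisors π)))))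
  where
  xs = replicate r c ++ parts π
  parts≤c : All (_≤ c) (parts π)
  parts≤c = subst (λ s → All (_≤ s) (parts π)) (sum≡ π) (All-≤-sum (parts π))
  head≥ : All (c ≥_) xs
  head≥ = All.++⁺ (All.replicate⁺ r ≤-refl) parts≤c
  tail-decreasing : AllPairs _≥_ xs
  tail-decreasing = AllPairs.++⁺ (replicate-decreasing r c) (decreasing π) (All.replicate⁺ r parts≤c)
  length-xs : length xs ≡ r + L
  length-xs = trans (length-++ (replicate r c)) (cong₂ _+_ (length-replicate r) (length≡ π))
  sum-xs : c + sum xs ≡ (2 + r) * c
  sum-xs = begin
    c + sum xs                               ≡⟨ cong (_+_ c) (sum-++ (replicate r c) (parts π)) ⟩
    c + (sum (replicate r c) + sum (parts π)) ≡⟨ cong (_+_ c) (cong₂ _+_ (sum-replicate r c) (sum≡ π)) ⟩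
    c + (r * c + c)                          ≡⟨ collect c r ⟩
    (2 + r) * c                              ∎
    where
    open ≡-Reasoning
    collect : ∀ c r → c + (r * c + c) ≡ (2 + r) * c
    collect = ℕ-Solver.solve-∀

structure-≤ : ∀ m c → 0 < c → c ≤ m → StructureWithMax m c
structure-≤ m (suc c) _ c≤m = subst (λ n → StructureWithMax n (suc c)) (m∸n+n≡m c≤m)
  (partition-structure (m ∸ suc c) (ones _ (suc c)) (here refl))

structure-binary : ∀ {m} k r x L → 2 ^ k ≡ 2 + r → r + L ≡ m → m < suc x → minParts k x < L →
  StructureWithMax m (suc x)
structure-binary {m} k r x L P≡ r+L≡m m<c mp<L
  with partitionWithOne k x L mp<L (≤-trans (subst (L ≤_) r+L≡m (m≤n+m L r)) (<⇒≤ m<c))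
... | π , 1∈ = subst (λ n → StructureWithMax n (suc x)) r+L≡m
  (partition-structure r (cast P≡ refl refl π) 1∈)

bound-ℕ : ∀ {c n k P d e} K → k + P ≡ d + K →
  + c ℤ.≤ + P ℤ.* + n ℤ.- (+ k ℤ.+ + P ℤ.- + d) ℤ.* + P ℤ.- + e →
  c + (K * P + e) ≤ P * n
bound-ℕ {c} {n} {k} {P} {d} {e} K k+P≡ c≤ = ℤₚ.drop‿+≤+ (begin
  + c ℤ.+ (+ (K * P) ℤ.+ + e)                  ≡⟨ cong (λ z → + c ℤ.+ (z ℤ.+ + e)) (ℤₚ.pos-* K P) ⟩
  + c ℤ.+ (+ K ℤ.* + P ℤ.+ + e)                ≤⟨ ℤₚ.+-monoˡ-≤ (+ K ℤ.* + P ℤ.+ + e) c≤′ ⟩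
  (+ P ℤ.* + n ℤ.- + K ℤ.* + P ℤ.- + e) ℤ.+ (+ K ℤ.* + P ℤ.+ + e) ≡⟨ cancel (+ P ℤ.* + n) (+ K ℤ.* + P) (+ e) ⟩
  + P ℤ.* + n                                  ≡⟨ ℤₚ.pos-* P n ⟨
  + (P * n)                                    ∎)
  where
  open ℤₚ.≤-Reasoning
  cancel : ∀ X Y E → (X ℤ.- Y ℤ.- E) ℤ.+ (Y ℤ.+ E) ≡ X
  cancel = ℤ-Solver.solve-∀
  cancel-d : ∀ D K → D ℤ.+ K ℤ.- D ≡ K
  cancel-d = ℤ-Solver.solve-∀
  c≤′ : + c ℤ.≤ + P ℤ.* + n ℤ.- + K ℤ.* + P ℤ.- + e
  c≤′ = subst (λ z → + c ℤ.≤ + P ℤ.* + n ℤ.- z ℤ.* + P ℤ.- + e)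
          (trans (cong (λ z → + z ℤ.- + d) k+P≡) (cancel-d (+ d) (+ K))) c≤

split-bound : ∀ {c K P e m} → 0 < e → c + (K * P + e) ≤ P * suc m →
  ∃[ Q ] (m ≡ K + Q × e + c ≤ suc Q * P)
split-bound {c} {K} {P} {e} {m} 0<e c≤ =
  let Q , K+Q≡m = m≤n⇒∃[o]m+o≡n (s≤s⁻¹ K<1+m) in
  Q , sym K+Q≡m , +-cancelˡ-≤ (K * P) (e + c) (suc Q * P) (begin
    K * P + (e + c)      ≡⟨ rearrange K P e c ⟩
    c + (K * P + e)      ≤⟨ c≤ ⟩
    P * suc m            ≡⟨ cong (λ z → P * suc z) K+Q≡m ⟨
    P * suc (K + Q)      ≡⟨ expand P K Q ⟩
    K * P + suc Q * P    ∎)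
  where
  open ≤-Reasoning
  rearrange : ∀ K P e c → K * P + (e + c) ≡ c + (K * P + e)
  rearrange = ℕ-Solver.solve-∀
  expand : ∀ P K Q → P * suc (K + Q) ≡ K * P + suc Q * P
  expand = ℕ-Solver.solve-∀
  K<1+m : K < suc m
  K<1+m = *-cancelʳ-< P K (suc m) (begin-strict
    K * P            <⟨ m<m+n (K * P) 0<e ⟩
    K * P + e        ≤⟨ m≤n+m (K * P + e) c ⟩
    c + (K * P + e)  ≤⟨ c≤ ⟩
    P * suc m        ≡⟨ *-comm P (suc m) ⟩
    suc m * P        ∎)

m+[2+n]≡2+[m+n] : ∀ m n → m + (2 + n) ≡ 2 + (m + n)
m+[2+n]≡2+[m+n] = ℕ-Solver.solve-∀

m+[n+o]≡o+m+n : ∀ m n o → m + (n + o) ≡ o + m + n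
m+[n+o]≡o+m+n = ℕ-Solver.solve-∀

structure-boundA : ∀ m c k → 0 < c → 0 < k → + c ℤ.≤ boundA (suc m) k → StructureWithMax m c
structure-boundA m c k 0<c 0<k c≤ with c ≤? m
... | yes c≤m = structure-≤ m c 0<c c≤m
structure-boundA m (suc x) k _ 0<k c≤ | no c≰m with 2^k≡2+r k 0<k
... | r , P≡ with split-bound {suc x} {e = 1} z<s
      (bound-ℕ {n = suc m} {k} {2 ^ k} {2} {1} (k + r) (trans (cong (_+_ k) P≡) (m+[2+n]≡2+[m+n] k r)) c≤)
... | Q , m≡ , c< = structure-binary k r x (Q + k) P≡ (trans (m+[n+o]≡o+m+n r Q k) (sym m≡))
  (≰⇒> c≰m) (minParts-< k x Q c<)

small-product<5 : ∀ r Q → r + Q ≤ 1 → suc Q * (2 + r) < 5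
small-product<5 0             0             _        = s≤s (s≤s (s≤s z≤n))
small-product<5 0             1             _        = s≤s (s≤s (s≤s (s≤s (s≤s z≤n))))
small-product<5 0             (suc (suc _)) (s≤s ())
small-product<5 1             0             _        = s≤s (s≤s (s≤s (s≤s z≤n)))
small-product<5 1             (suc _)       (s≤s ())
small-product<5 (suc (suc _)) _             (s≤s ())

structure-boundB : ∀ m p k → Prime p → 0 < k → + p ℤ.≤ boundB (suc m) k → StructureWithMax m p
structure-boundB m p k pr 0<k p≤ with p ≤? m
... | yes p≤m = structure-≤ m p (>-nonZero⁻¹ p {{prime⇒nonZero pr}}) p≤m
structure-boundB m p (suc j) pr _ p≤ | no p≰m with 2^k≡2+r (suc j) z<s
... | r , P≡ with split-bound {p} {e = 3} z<s
      (bound-ℕ {n = suc m} {suc j} {2 ^ suc j} {3} {3} (j + r)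
        (cong suc (trans (cong (_+_ j) P≡) (m+[2+n]≡2+[m+n] j r))) p≤)
... | Q , m≡ , p< with even⊎odd p
-- p = 2 > m leaves no room for the bound
...   | inj₁ 2∣p = contradiction (subst₂ (λ p P → 3 + p ≤ suc Q * P) p≡2 P≡ p<)
  (<⇒≱ (small-product<5 r Q (≤-trans (m≤n+m (r + Q) j) (≤-trans (≤-reflexive j+[r+Q]≡m) m≤1))))
  where
  p≡2 = even-prime pr 2∣p
  m≤1 : m ≤ 1
  m≤1 = s≤s⁻¹ (subst (m <_) p≡2 (≰⇒> p≰m))
  j+[r+Q]≡m : j + (r + Q) ≡ m
  j+[r+Q]≡m = trans (sym (+-assoc j r Q)) (sym m≡)
...   | inj₂ p≡ = subst (StructureWithMax m) (sym p≡)
  (structure-binary (suc j) r (p / 2 * 2) (Q + j) P≡ (trans (m+[n+o]≡o+m+n r Q j) (sym m≡))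
    (subst (m <_) p≡ (≰⇒> p≰m))
    (subst (_< Q + j) (sym (minParts-double j (p / 2))) (minParts-< j (p / 2) Q half<)))
  where
  half< : suc (p / 2) < suc Q * 2 ^ j
  half< = *-cancelʳ-< 2 _ _ (begin-strict
    suc (p / 2) * 2       ≡⟨ cong suc p≡ ⟨
    suc p                 <⟨ m<n+m (suc p) {2} z<s ⟩
    3 + p                 ≤⟨ p< ⟩
    suc Q * 2 ^ suc j     ≡⟨ m*2^[1+n]≡m*2^n*2 (suc Q) j ⟩
    suc Q * 2 ^ j * 2     ∎)
    where open ≤-Reasoning

theorem2p1 : ∀ (m : ℕ) →
    ((c : ℕ) → 1 ≤ c → (∃[ k ] (1 ≤ k × (+ c) ℤ.≤ boundA (suc m) k)) →
      ∃[ r ] (IsArithmeticalStructure {suc m} r × lookup r zero ≡ c))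
    × ((p : ℕ) → Prime p → (∃[ k ] (1 ≤ k × (+ p) ℤ.≤ boundB (suc m) k)) →
      ∃[ r ] (IsArithmeticalStructure {suc m} r × lookup r zero ≡ p))
theorem2p1 m =
  (λ c 0<c (k , 0<k , c≤) → structure-boundA m c k 0<c 0<k c≤) ,
  (λ p pr (k , 0<k , p≤) → structure-boundB m p k pr 0<k p≤)
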